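{- Let $G$ be a connected graph with at least three vertices, let $H$ be a square root of $G$, and let $S\subseteq V(G)$ be such that $H-S$ is isomorphic to $pK_1+qK_2$ for some $p,q$. Let $a_1b_1$ and $a_2b_2$ be two distinct $S$-matching edges of type 3 such that $N_H(a_1)\cap S=N_H(a_2)\cap S$ and $N_H(b_1)\cap S=N_H(b_2)\cap S$. Then (i) $(a_1,b_1)\not\sim_{mt}(a_2,b_2)$; (ii) $(a_1,b_1)\not\sim_{nt}(a_2,b_2)$; (iii) $a_1$ and $a_2$ are true twins in $G$, and $b_1$ and $b_2$ are true twins in $G$.
   Context: Graphs are finite, simple, undirected. $H$ is a square root of $G$ if $V(H)=V(G)$ and two distinct vertices are adjacent in $G$ iff their distance in $H$ is at most two. $pK_1+qK_2$ is the disjoint union of $p$ isolated vertices and $q$ disjoint edges. The edges of $H-S$ are called $S$-matching edges. An $S$-matching edge $ab$ is of type 1 if $N_H(a)\cap S=\emptyset$ and $N_H(b)\cap S\neq\emptyset$; of type 2 if $N_H(a)\cap S$, $N_H(b)\cap S$ are both nonempty and disjoint; of type 3 if they are both nonempty and intersect. Vertices $u,v$ are true twins in $G$ if $N_G[u]=N_G[v]$. For a graph $G$: ordered pairs $(x,y)$, $(z,w)$ of adjacent vertices are matched twins, $(x,y)\sim_{mt}(z,w)$, if $N_G[x]\setminus\{y\}=N_G[z]\setminus\{w\}$ and $N_G[y]\setminus\{x\}=N_G[w]\setminus\{z\}$; a pair $(x,y)$ is comparable if $N_G[x]\subseteq N_G[y]$; comparable pairs are nested twins, $(x,y)\sim_{nt}(z,w)$,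 if $N_G(x)\setminus\{y\}=N_G(z)\setminus\{w\}$ and $N_G[y]\setminus\{x\}=N_G[w]\setminus\{z\}$ (the relation is considered false if either pair is not comparable). -}

module Defs where

open import Data.Nat using (ℕ)
open import Data.Bool using (Bool; true; false)
open import Data.Fin using (Fin)
open import Data.Sum using (_⊎_)
open import Data.Product using (Σ; ∃; _×_; proj₁)
open import Data.Empty using (⊥)
open import Relation.Nullary using (¬_)
open import Relation.Binary.PropositionalEquality using (_≡_; _≢_)
open import Function.Bundles using (_⇔_; _↔_; Inverse)

record Graph (n : ℕ) : Set where
  field
    adj    : Fin n → Fin n → Bool
    sym    : ∀ u v → adj u v ≡ adj v u
    irrefl : ∀ v → adj v v ≡ false
open Graph public

E : ∀ {n} → Graph n → Fin n → Fin n → Set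
E G u v = adj G u v ≡ true

data Reach {n} (G : Graph n) : Fin n → Fin n → Set where
  here : ∀ {u} → Reach G u u
  step : ∀ {u v w} → E G u v → Reach G v w → Reach G u w

Connected : ∀ {n} → Graph n → Set
Connected {n} G = (u v : Fin n) → Reach G u v

IsSquareRoot : ∀ {n} → Graph n → Graph n → Set
IsSquareRoot {n} H G = (u v : Fin n) → u ≢ v →
  (E G u v ⇔ (E H u v ⊎ ∃ λ w → E H u w × E H w v))

Out : ∀ {n} → (Fin n → Bool) → Set
Out {n} S = Σ (Fin n) λ v → S v ≡ false

-- the graph pK1 + qK2 on vertex set Fin p ⊎ (Fin q × Bool)
KVert : ℕ → ℕ → Set
KVert p q = Fin p ⊎ (Fin q × Bool)

KAdj : ∀ {p q} → KVert p q → KVert p q → Set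
KAdj (_⊎_.inj₂ (i Data.Product., b)) (_⊎_.inj₂ (j Data.Product., c)) = i ≡ j × b ≢ c
KAdj _ _ = ⊥

MinusIsoPK1qK2 : ∀ {n} → Graph n → (Fin n → Bool) → ℕ → ℕ → Set
MinusIsoPK1qK2 H S p q =
  Σ (Out S ↔ KVert p q) λ f →
    ∀ x y → E H (proj₁ x) (proj₁ y) ⇔ KAdj (Inverse.to f x) (Inverse.to f y)

SMatchingEdge : ∀ {n} → Graph n → (Fin n → Bool) → Fin n → Fin n → Set
SMatchingEdge H S a b = S a ≡ false × S b ≡ false × E H a b

MeetsS : ∀ {n} → Graph n → (Fin n → Bool) → Fin n → Set
MeetsS H S a = ∃ λ s → S s ≡ true × E H a s

Type3 : ∀ {n} → Graph n → (Fin n → Bool) → Fin n → Fin n → Set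
Type3 H S a b = MeetsS H S a × MeetsS H S b × (∃ λ s → S s ≡ true × E H a s × E H b s)

InN[_] : ∀ {n} → Graph n → Fin n → Fin n → Set
InN[ G ] x u = u ≡ x ⊎ E G x u

InN : ∀ {n} → Graph n → Fin n → Fin n → Set
InN G x u = E G x u

ClosedMinusEq : ∀ {n} → Graph n → Fin n → Fin n → Fin n → Fin n → Set
ClosedMinusEq {n} G x y z w = (u : Fin n) → (InN[ G ] x u × u ≢ y) ⇔ (InN[ G ] z u × u ≢ w)

OpenMinusEq : ∀ {n} → Graph n → Fin n → Fin n → Fin n → Fin n → Set
OpenMinusEq {n} G x y z w = (u : Fin n) → (InN G x u × u ≢ y) ⇔ (InN G z u × u ≢ w)

MatchedTwins : ∀ {n} → Graph n → Fin n → Fin n → Fin n → Fin n → Set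
MatchedTwins G x y z w =
  E G x y × E G z w × ClosedMinusEq G x y z w × ClosedMinusEq G y x w z

Comparable : ∀ {n} → Graph n → Fin n → Fin n → Set
Comparable {n} G x y = (u : Fin n) → InN[ G ] x u → InN[ G ] y u

NestedTwins : ∀ {n} → Graph n → Fin n → Fin n → Fin n → Fin n → Set
NestedTwins G x y z w =
  Comparable G x y × Comparable G z w × OpenMinusEq G x y z w × ClosedMinusEq G y x w z

TrueTwins : ∀ {n} → Graph n → Fin n → Fin n → Set
TrueTwins {n} G u v = (z : Fin n) → InN[ G ] u z ⇔ InN[ G ] v z

DistinctEdges : ∀ {n} → Fin n → Fin n → Fin n → Fin n → Set
DistinctEdges a1 b1 a2 b2 = ¬ ((a1 ≡ a2 × b1 ≡ b2) ⊎ (a1 ≡ b2 × b1 ≡ a2))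

{-# OPTIONS --safe #-}
module Submission where

-- Since H − S is a matching, an H-walk of length at most two from an end x of
-- an S-matching edge xy either enters S at its first step or crosses to y.
-- So if x₁y₁ and x₂y₂ see the same vertices of S and s ∈ S is adjacent to
-- x₁ and y₁ (hence to x₂), every such walk from x₁ is shadowed by a walk of
-- length at most two from x₂ through S, through y₂, or through s; thus
-- N_G[x₁] ⊆ N_G[x₂].  For (i) and (ii): b₂ is a G-neighbour of a₁ (through s)
-- other than b₁, yet it is the vertex removed from the neighbourhood of a₂.

open import Defs
open import Data.Nat using (ℕ; _≤_)
open import Data.Bool using (Bool; true; false)
open import Data.Bool.Properties using (¬-not)
open import Data.Fin using (Fin; _≟_)
open import Data.Product using (Σ; ∃; _×_; _,_; proj₁; proj₂)
open import Data.Sum using (_⊎_; inj₁; inj₂)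
open import Relation.Nullary using (¬_; yes; no)
open import Relation.Binary.PropositionalEquality
  using (_≡_; _≢_; refl; cong; trans; ≢-sym) renaming (sym to ≡-sym)
open import Function.Bundles using (Equivalence; Injection; mk⇔)
open import Function.Properties.Inverse using (Inverse⇒Injection)

E-sym : ∀ {n} (H : Graph n) {u v} → E H u v → E H v u
E-sym H {u} {v} e = trans (Graph.sym H v u) e

E⇒≢ : ∀ {n} (H : Graph n) {u v} → E H u v → u ≢ v
E⇒≢ H {u} e refl with trans (≡-sym e) (Graph.irrefl H u)
... | ()

KAdj-functional : ∀ {p q} {u v w : KVert p q} → KAdj u v → KAdj u w → v ≡ w
KAdj-functional {u = inj₁ _} ()
KAdj-functional {u = inj₂ _} {inj₁ _} ()
KAdj-functional {u = inj₂ _} {inj₂ _} {inj₁ _} _ ()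
KAdj-functional {u = inj₂ _} {inj₂ _} {inj₂ _} (refl , b≢c) (refl , b≢d) =
  cong (λ c → inj₂ (_ , c)) (trans (¬-not (≢-sym b≢c)) (≡-sym (¬-not (≢-sym b≢d))))

MinusIsMatching : ∀ {n} → Graph n → (Fin n → Bool) → Set
MinusIsMatching {n} H S = ∀ {a b c : Fin n} → S a ≡ false → S b ≡ false → S c ≡ false →
  E H a b → E H a c → b ≡ c

WithinTwo : ∀ {n} → Graph n → Fin n → Fin n → Set
WithinTwo H u v = E H u v ⊎ ∃ λ w → E H u w × E H w v

SameSNeighbours : ∀ {n} → Graph n → (Fin n → Bool) → Fin n → Fin n → Set
SameSNeighbours H S x y = ∀ t → S t ≡ true → adj H x t ≡ adj H y t

SNeighbours⊆ : ∀ {n} → Graph n → (Fin n → Bool) → Fin n → Fin n → Set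
SNeighbours⊆ {n} H S x y = ∀ {t : Fin n} → S t ≡ true → E H x t → E H y t

module SquareRoot {n} {G H : Graph n} (root : IsSquareRoot H G) where

  N[G]⇒withinTwo : ∀ {x z} → InN[ G ] x z → z ≡ x ⊎ WithinTwo H x z
  N[G]⇒withinTwo (inj₁ z≡x) = inj₁ z≡x
  N[G]⇒withinTwo {x} {z} (inj₂ xz) = inj₂ (Equivalence.to (root x z (E⇒≢ G xz)) xz)

  withinTwo⇒N[G] : ∀ {x z} → WithinTwo H x z → InN[ G ] x z
  withinTwo⇒N[G] {x} {z} near with z ≟ x
  ... | yes z≡x = inj₁ z≡x
  ... | no z≢x  = inj₂ (Equivalence.from (root x z (≢-sym z≢x)) near)

module RelativeTo {n} (H : Graph n) (S : Fin n → Bool) where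

  SMatchingEdge-sym : ∀ {a b} → SMatchingEdge H S a b → SMatchingEdge H S b a
  SMatchingEdge-sym (Sa , Sb , ab) = Sb , Sa , E-sym H ab

  minusIsoPK1qK2⇒minusIsMatching : ∀ {p q} → MinusIsoPK1qK2 H S p q → MinusIsMatching H S
  minusIsoPK1qK2⇒minusIsMatching (f , iso) {a} {b} {c} Sa Sb Sc ab ac =
    cong proj₁ (Injection.injective (Inverse⇒Injection f)
      (KAdj-functional (Equivalence.to (iso (a , Sa) (b , Sb)) ab)
                       (Equivalence.to (iso (a , Sa) (c , Sc)) ac)))

  sameSNeighbours⇒⊆ : ∀ {x y} → SameSNeighbours H S x y → SNeighbours⊆ H S x y
  sameSNeighbours⇒⊆ same {t} St xt = trans (≡-sym (same t St)) xt

  sameSNeighbours⇒⊇ : ∀ {x y} → SameSNeighbours H S x y → SNeighbours⊆ H S y x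
  sameSNeighbours⇒⊇ same {t} St yt = trans (same t St) yt

  module MinusMatching (matching : MinusIsMatching H S) where

    distinctEdges⇒b₂≢b₁ : ∀ {a₁ b₁ a₂ b₂} → SMatchingEdge H S a₁ b₁ → SMatchingEdge H S a₂ b₂ →
      DistinctEdges a₁ b₁ a₂ b₂ → b₂ ≢ b₁
    distinctEdges⇒b₂≢b₁ (Sa₁ , Sb₁ , a₁b₁) (Sa₂ , _ , a₂b₂) distinct refl =
      distinct (inj₁ (matching Sb₁ Sa₁ Sa₂ (E-sym H a₁b₁) (E-sym H a₂b₂) , refl))

    distinctEdges⇒a₁≢b₂ : ∀ {a₁ b₁ a₂ b₂} → SMatchingEdge H S a₁ b₁ → SMatchingEdge H S a₂ b₂ →
      DistinctEdges a₁ b₁ a₂ b₂ → a₁ ≢ b₂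
    distinctEdges⇒a₁≢b₂ (Sa₁ , Sb₁ , a₁b₁) (Sa₂ , _ , a₂b₂) distinct refl =
      distinct (inj₂ (refl , matching Sa₁ Sb₁ Sa₂ a₁b₁ (E-sym H a₂b₂)))

    withinTwo-shadowed : ∀ {x₁ y₁ x₂ y₂ s} → SMatchingEdge H S x₁ y₁ → E H x₂ y₂ →
      S s ≡ true → E H x₁ s → E H y₁ s →
      SNeighbours⊆ H S x₁ x₂ → SNeighbours⊆ H S y₁ y₂ →
      ∀ {z} → z ≡ x₁ ⊎ WithinTwo H x₁ z → WithinTwo H x₂ z
    withinTwo-shadowed {x₁} {y₁} {x₂} {y₂} {s} (Sx₁ , Sy₁ , x₁y₁) x₂y₂ Ss x₁s y₁s x₁⊆x₂ y₁⊆y₂ =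
      shadow
      where
      x₂s : E H x₂ s
      x₂s = x₁⊆x₂ Ss x₁s

      oneStep : ∀ {z} → z ≡ x₁ ⊎ E H x₁ z → WithinTwo H x₂ z
      oneStep (inj₁ refl) = inj₂ (s , x₂s , E-sym H x₁s)
      oneStep {z} (inj₂ x₁z) with S z in Sz
      ... | true = inj₁ (x₁⊆x₂ Sz x₁z)
      ... | false with matching Sx₁ Sy₁ Sz x₁y₁ x₁z
      ...   | refl = inj₂ (s , x₂s , E-sym H y₁s)

      twoSteps : ∀ {w z} → E H x₁ w → E H w z → WithinTwo H x₂ z
      twoSteps {w} {z} x₁w wz with S w in Sw
      ... | true = inj₂ (w , x₁⊆x₂ Sw x₁w , wz)
      ... | false with matching Sx₁ Sy₁ Sw x₁y₁ x₁w
      ...   | refl with S z in Sz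
      ...     | true = inj₂ (y₂ , x₂y₂ , y₁⊆y₂ Sz wz)
      ...     | false = oneStep (inj₁ (≡-sym (matching Sy₁ Sx₁ Sz (E-sym H x₁y₁) wz)))

      shadow : ∀ {z} → z ≡ x₁ ⊎ WithinTwo H x₁ z → WithinTwo H x₂ z
      shadow (inj₁ z≡x₁)                  = oneStep (inj₁ z≡x₁)
      shadow (inj₂ (inj₁ x₁z))            = oneStep (inj₂ x₁z)
      shadow (inj₂ (inj₂ (w , x₁w , wz))) = twoSteps x₁w wz

    N[G]-⊆ : ∀ {G : Graph n} → IsSquareRoot H G →
      ∀ {x₁ y₁ x₂ y₂ s} → SMatchingEdge H S x₁ y₁ → E H x₂ y₂ →
      S s ≡ true → E H x₁ s → E H y₁ s →
      SNeighbours⊆ H S x₁ x₂ → SNeighbours⊆ H S y₁ y₂ →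
      ∀ {z} → InN[ G ] x₁ z → InN[ G ] x₂ z
    N[G]-⊆ {G} root e₁ x₂y₂ Ss x₁s y₁s x₁⊆x₂ y₁⊆y₂ z∈N[x₁] =
      withinTwo⇒N[G]
        (withinTwo-shadowed e₁ x₂y₂ Ss x₁s y₁s x₁⊆x₂ y₁⊆y₂ (N[G]⇒withinTwo z∈N[x₁]))
      where open SquareRoot {G = G} {H = H} root

    sameSNeighbours⇒trueTwins : ∀ {G : Graph n} → IsSquareRoot H G →
      ∀ {x₁ y₁ x₂ y₂ s} → SMatchingEdge H S x₁ y₁ → SMatchingEdge H S x₂ y₂ →
      S s ≡ true → E H x₁ s → E H y₁ s →
      SameSNeighbours H S x₁ x₂ → SameSNeighbours H S y₁ y₂ → TrueTwins G x₁ x₂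
    sameSNeighbours⇒trueTwins {G} root e₁ e₂ Ss x₁s y₁s sameX sameY z =
      mk⇔ (N[G]-⊆ {G} root e₁ (proj₂ (proj₂ e₂)) Ss x₁s y₁s
                  (sameSNeighbours⇒⊆ sameX) (sameSNeighbours⇒⊆ sameY))
          (N[G]-⊆ {G} root e₂ (proj₂ (proj₂ e₁)) Ss
                  (sameSNeighbours⇒⊆ sameX Ss x₁s) (sameSNeighbours⇒⊆ sameY Ss y₁s)
                  (sameSNeighbours⇒⊇ sameX) (sameSNeighbours⇒⊇ sameY))

mainTheorem11 : ∀ {n} (G H : Graph n) (S : Fin n → Bool) →
    3 ≤ n → Connected G → IsSquareRoot H G →
    (Σ ℕ λ p → Σ ℕ λ q → MinusIsoPK1qK2 H S p q) →
    (a₁ b₁ a₂ b₂ : Fin n) →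
    SMatchingEdge H S a₁ b₁ → SMatchingEdge H S a₂ b₂ →
    DistinctEdges a₁ b₁ a₂ b₂ →
    Type3 H S a₁ b₁ → Type3 H S a₂ b₂ →
    (∀ s → S s ≡ true → adj H a₁ s ≡ adj H a₂ s) →
    (∀ s → S s ≡ true → adj H b₁ s ≡ adj H b₂ s) →
    ¬ MatchedTwins G a₁ b₁ a₂ b₂ × ¬ NestedTwins G a₁ b₁ a₂ b₂ ×
    TrueTwins G a₁ a₂ × TrueTwins G b₁ b₂
mainTheorem11 G H S _ _ root (_ , _ , iso) a₁ b₁ a₂ b₂ e₁ e₂ distinct
  (_ , _ , s , Ss , a₁s , b₁s) _ sameA sameB =
    (λ (_ , _ , N[a₁]∖b₁≡N[a₂]∖b₂ , _) →
       b₂-removed (Equivalence.to (N[a₁]∖b₁≡N[a₂]∖b₂ b₂) (inj₂ a₁b₂ , b₂≢b₁)))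
  , (λ (_ , _ , N⟨a₁⟩∖b₁≡N⟨a₂⟩∖b₂ , _) →
       b₂-removed (Equivalence.to (N⟨a₁⟩∖b₁≡N⟨a₂⟩∖b₂ b₂) (a₁b₂ , b₂≢b₁)))
  , sameSNeighbours⇒trueTwins {G} root e₁ e₂ Ss a₁s b₁s sameA sameB
  , sameSNeighbours⇒trueTwins {G} root
      (SMatchingEdge-sym e₁) (SMatchingEdge-sym e₂) Ss b₁s a₁s sameB sameA
  where
  open RelativeTo H S
  open MinusMatching (minusIsoPK1qK2⇒minusIsMatching iso)

  b₂≢b₁ : b₂ ≢ b₁
  b₂≢b₁ = distinctEdges⇒b₂≢b₁ e₁ e₂ distinct

  a₁b₂ : E G a₁ b₂
  a₁b₂ = Equivalence.from (root a₁ b₂ (distinctEdges⇒a₁≢b₂ e₁ e₂ distinct))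
           (inj₂ (s , a₁s , E-sym H (sameSNeighbours⇒⊆ sameB Ss b₁s)))

  b₂-removed : {P : Set} → ¬ (P × b₂ ≢ b₂)
  b₂-removed (_ , b₂≢b₂) = b₂≢b₂ refl
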